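{- Let $h:[n]\to[n]$ be a Hessenberg function, $\lambda=(\lambda_1,\dots,\lambda_k)\vdash n$ a partition with exactly $k$ parts, and $T\in\mathrm{SK}_k(\Gamma_h)$. Under the identification $\phi_T:\Phi[T]\to\Phi_{n-k}$, $t_i-t_j\mapsto t_{f_T(i)}-t_{f_T(j)}$: (1) $w_T^{ -1}(\mathbb{J}_\lambda)\cap\Phi[T]$ is mapped onto $\mathbb{J}_{\lambda[1]}$; (2) $w_T^{ -1}(\Delta\setminus\mathbb{J}_\lambda)\cap\Phi[T]$ is mapped onto $\{\alpha_1,\dots,\alpha_{n-k-1}\}\setminus\mathbb{J}_{\lambda[1]}$, where $\lambda[1]=(\lambda_1-1,\dots,\lambda_k-1)$.
   Context: For $\mathfrak{gl}(m,\mathbb{C})$, $\Phi_m$ is the set of roots $t_i-t_j$ ($i\ne j$, $i,j\in[m]$) and $\Delta_m=\{\alpha_j=t_j-t_{j+1}:1\le j\le m-1\}$; $\Delta=\Delta_n$; $w(t_i-t_j)=t_{w(i)}-t_{w(j)}$. For $\mu\vdash m$ with $p$ parts, $J_\mu=\Delta_m\setminus\{\alpha_{\mu_1},\dots,\alpha_{\mu_1+\cdots+\mu_{p-1}}\}$, and $\mathbb{J}_\lambda=\Delta_m\setminus J_{\lambda^\vee}$ with $\lambda^\vee$ the dual partition ($\mathbb{J}_{\lambda[1]}\subseteq\Delta_{n-k}$). $\Gamma_h$: vertices $[n]$, edges $\{a,b\}$, $a<b\le h(a)$ ($h$ nondecreasing with $h(j)\ge j$); $\mathrm{SK}_k(\Gamma_h)$: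 independent vertex sets of size $k$. For $T=\{\ell_1<\cdots<\ell_k\}$: $\Phi[T]=\{t_i-t_j\in\Phi_n:\{i,j\}\cap T=\emptyset\}$; $f_T:[n]\setminus T\to[n-k]$, $f_T(j)=j-|\{t\in T:t\le j\}|$; $w_T\in\mathfrak{S}_n$ has $w_T(\ell_j)=k-j+1$ ($1\le j\le k$) and the positions in $[n]\setminus T$, left to right, carry $k+1,\dots,n$ in increasing order. -}

module Defs where

open import Data.Nat using (ℕ; zero; suc; _+_; _∸_; _≤_; _<_; _≥_; _≤?_; _≟_; _⊔_)
open import Data.List using (List; []; _∷_; map; filter; length; upTo; foldr)
open import Data.Nat.ListAction using (sum)
open import Data.List.Membership.Propositional using (_∈_)
open import Data.List.Membership.DecPropositional _≟_ using (_∈?_)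
open import Data.List.Relation.Unary.All using (All)
open import Data.List.Relation.Unary.Linked using (Linked)
open import Data.Product using (_×_; Σ; ∃; _,_)
open import Relation.Nullary using (¬_; yes; no)
open import Relation.Binary.PropositionalEquality using (_≡_; _≢_)

-- All indices are 1-based natural numbers, as in the paper.

-- Hessenberg function h : [n] → [n]  (values outside [n] irrelevant)
IsHessenberg : ℕ → (ℕ → ℕ) → Set
IsHessenberg n h =
  (∀ j → 1 ≤ j → j ≤ n → j ≤ h j × h j ≤ n) ×
  (∀ i j → 1 ≤ i → i ≤ j → j ≤ n → h i ≤ h j)

IsPartition : ℕ → ℕ → List ℕ → Set
IsPartition n k λ′ = All (1 ≤_) λ′ × Linked _≥_ λ′ × sum λ′ ≡ n × length λ′ ≡ k

-- SK_k(Γ_h): independent k-sets of Γ_h, a set T = {ℓ₁ < ⋯ < ℓ_k} ⊆ [n]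
-- represented as the strictly increasing list ℓ₁ , … , ℓ_k.
-- Edges of Γ_h: {a,b} with a < b ≤ h a.
IsSK : ℕ → (ℕ → ℕ) → ℕ → List ℕ → Set
IsSK n h k T =
  Linked _<_ T × All (λ t → 1 ≤ t × t ≤ n) T × length T ≡ k ×
  (∀ a b → a ∈ T → b ∈ T → a < b → ¬ (b ≤ h a))

-- roots t_i - t_j are encoded as pairs (i , j)
Root : Set
Root = ℕ × ℕ

InΦ : ℕ → Root → Set
InΦ m (i , j) = (1 ≤ i × i ≤ m) × (1 ≤ j × j ≤ m) × i ≢ j

α : ℕ → Root
α j = (j , suc j)

InΔ : ℕ → Root → Set
InΔ m β = Σ ℕ λ j → 1 ≤ j × suc j ≤ m × β ≡ α j

cuts : List ℕ → List ℕ
cuts [] = []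
cuts (x ∷ []) = []
cuts (x ∷ y ∷ ys) = x ∷ map (x +_) (cuts (y ∷ ys))

-- J_μ = Δ_m \ {α_{μ₁}, …, α_{μ₁+⋯+μ_{p-1}}}
InJ : ℕ → List ℕ → Root → Set
InJ m μ β = InΔ m β × ¬ (Σ ℕ λ s → s ∈ cuts μ × β ≡ α s)

maxPart : List ℕ → ℕ
maxPart = foldr _⊔_ 0

-- dual partition: λ^∨_i = #{ j : λ_j ≥ i }, i = 1 … λ₁
dual : List ℕ → List ℕ
dual λ′ = map (λ i → length (filter (suc i ≤?_) λ′)) (upTo (maxPart λ′))

In𝕁 : ℕ → List ℕ → Root → Set
In𝕁 m λ′ β = InΔ m β × ¬ InJ m (dual λ′) β

-- λ[1] = (λ₁ - 1, …, λ_k - 1)   (zero parts are harmless for `dual`)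
shift1 : List ℕ → List ℕ
shift1 = map (_∸ 1)

countLe : List ℕ → ℕ → ℕ
countLe T j = length (filter (_≤? j) T)

f : List ℕ → ℕ → ℕ
f T j = j ∸ countLe T j

-- w_T : w_T(ℓ_j) = k - j + 1 (here j = countLe T ℓ_j), and the r-th position
-- of [n] \ T from the left carries k + r, where r = f_T(p).
w : ℕ → List ℕ → ℕ → ℕ
w k T p with p ∈? T
... | yes _ = suc k ∸ countLe T p
... | no _  = k + f T p

wRoot : ℕ → List ℕ → Root → Root
wRoot k T (i , j) = (w k T i , w k T j)

InΦT : ℕ → List ℕ → Root → Set
InΦT n T (i , j) = InΦ n (i , j) × ¬ (i ∈ T) × ¬ (j ∈ T)

φ : List ℕ → Root → Root
φ T (i , j) = (f T i , f T j)

module Submission where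

-- Write m ↦ k + m for the translation of indices.  For an index
-- p ∉ T the permutation w_T sends p to k + f_T(p), so on Φ[T] the action of
-- w_T is φ_T followed by this translation:  w_T(β) = k + φ_T(β).  Hence both
-- parts of the lemma reduce to two facts.
--   (i)  Simple roots.  Since f_T climbs through 1, 2, …, n - k in unit steps
--        along [n] \ T, every simple root α_m of Δ_{n-k} is φ_T of a root of
--        Φ[T]; and if w_T(β) is simple then φ_T(β) is simple, because f_T is
--        positive off T.
--   (ii) Cuts.  For λ with k positive parts, λ^∨ = (k, λ[1]^∨), so the cuts of
--        λ^∨ are the cuts of λ[1]^∨ translated by k, plus k itself.  Hence
--        α_m ∈ 𝕁_{λ[1]} iff α_{k+m} ∈ 𝕁_λ.

open import Defs
open import Data.Nat using (ℕ; zero; suc; _+_; _∸_; _≤_; _<_; _⊔_; z≤n; s≤s)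
open import Data.Nat.Properties
open import Data.List using (List; []; _∷_; map; filter; length; upTo; applyUpTo)
open import Data.List.Properties using (map-applyUpTo; map-cong; length-filter; filter-all; filter-accept; filter-reject)
open import Data.List.Membership.Propositional using (_∈_)
open import Data.List.Membership.Propositional.Properties using (∈-map⁺; ∈-map⁻)
open import Data.List.Membership.DecPropositional _≟_ using (_∈?_)
open import Data.List.Relation.Unary.All as All using (All; []; _∷_)
import Data.List.Relation.Unary.All.Properties as AllP
open import Data.List.Relation.Unary.Any using (here; there)
open import Data.List.Relation.Unary.Linked as Linked using (Linked; [-]; _∷_)
import Data.List.Relation.Unary.Linked.Properties as LinkedP
open import Data.Product using (_×_; Σ; _,_; proj₁)
open import Data.Product.Properties using (,-injectiveˡ; ,-injectiveʳ)
open import Data.Empty using (⊥-elim)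
open import Function using (_∘_)
open import Relation.Binary.Definitions using (tri<; tri≈; tri>)
open import Relation.Nullary using (¬_; yes; no)
open import Relation.Binary.PropositionalEquality
open import Function.Bundles using (_⇔_; mk⇔)

mult : ℕ → List ℕ → ℕ
mult x T = length (filter (x ≟_) T)

countLe-suc : ∀ T p → countLe T (suc p) ≡ countLe T p + mult (suc p) T
countLe-suc [] p = refl
countLe-suc (x ∷ T) p with <-cmp x (suc p)
... | tri< x<1+p x≢1+p _
  rewrite filter-accept (_≤? suc p) {x} {T} (<⇒≤ x<1+p)
        | filter-accept (_≤? p) {x} {T} (≤-pred x<1+p)
        | filter-reject (suc p ≟_) {x} {T} (x≢1+p ∘ sym)
  = cong suc (countLe-suc T p)
... | tri≈ _ refl _
  rewrite filter-accept (_≤? suc p) {suc p} {T} ≤-refl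
        | filter-reject (_≤? p) {suc p} {T} (n≮n p)
        | filter-accept (suc p ≟_) {suc p} {T} refl
  = trans (cong suc (countLe-suc T p)) (sym (+-suc _ _))
... | tri> _ x≢1+p 1+p<x
  rewrite filter-reject (_≤? suc p) {x} {T} (<⇒≱ 1+p<x)
        | filter-reject (_≤? p) {x} {T} (<⇒≱ (<-trans (n<1+n p) 1+p<x))
        | filter-reject (suc p ≟_) {x} {T} (x≢1+p ∘ sym)
  = countLe-suc T p

mult-∈ : ∀ {x T} → x ∈ T → 1 ≤ mult x T
mult-∈ {x} {_ ∷ T} (here refl) rewrite filter-accept (x ≟_) {x} {T} refl = s≤s z≤n
mult-∈ {x} {y ∷ T} (there x∈T) with x ≟ y
... | yes x≡y rewrite filter-accept (x ≟_) {y} {T} x≡y = s≤s z≤n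
... | no x≢y rewrite filter-reject (x ≟_) {y} {T} x≢y = mult-∈ x∈T

mult-∉ : ∀ {x} T → ¬ x ∈ T → mult x T ≡ 0
mult-∉ [] _ = refl
mult-∉ {x} (y ∷ T) x∉ rewrite filter-reject (x ≟_) {y} {T} (x∉ ∘ here) = mult-∉ T (x∉ ∘ there)

head-below : ∀ {x L} → Linked _<_ (x ∷ L) → All (x <_) L
head-below [-] = []
head-below (x<y ∷ l) = LinkedP.Linked⇒All <-trans x<y l

strict-length-bound : ∀ {a b} L → Linked _<_ L → All (λ x → a < x × x ≤ b) L →
                      length L ≤ b ∸ a
strict-length-bound [] _ _ = z≤n
strict-length-bound {a} {b} (x ∷ L) l ((a<x , x≤b) ∷ bounds) = begin
  suc (length L)  ≤⟨ s≤s (strict-length-bound L (Linked.tail l) bounds′) ⟩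
  suc (b ∸ x)     ≡⟨ sym (+-∸-assoc 1 x≤b) ⟩
  suc b ∸ x       ≤⟨ ∸-monoʳ-≤ (suc b) a<x ⟩
  b ∸ a           ∎
  where
  open ≤-Reasoning
  bounds′ : All (λ y → x < y × y ≤ b) L
  bounds′ = All.zipWith (λ (x<y , (_ , y≤b)) → x<y , y≤b) (head-below l , bounds)

countLe-bound : ∀ T q → Linked _<_ T → All (0 <_) T → countLe T q ≤ q
countLe-bound T q l pos =
  strict-length-bound (filter (_≤? q) T) (LinkedP.filter⁺ (_≤? q) <-trans l)
    (All.zip (AllP.filter⁺ (_≤? q) pos , AllP.all-filter (_≤? q) T))

f-step : ∀ T p → f T (suc p) ≤ suc (f T p)
f-step T p = begin
  suc p ∸ countLe T (suc p)     ≡⟨ cong (suc p ∸_) (countLe-suc T p) ⟩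
  suc p ∸ (c + mult (suc p) T)  ≤⟨ ∸-monoʳ-≤ (suc p) (m≤m+n c _) ⟩
  suc p ∸ c                     ≤⟨ m≤n+o⇒m∸n≤o (suc p) c 1+p≤c+[1+p∸c] ⟩
  suc (p ∸ c)                   ∎
  where
  open ≤-Reasoning
  c : ℕ
  c = countLe T p
  1+p≤c+[1+p∸c] : suc p ≤ c + suc (p ∸ c)
  1+p≤c+[1+p∸c] = ≤-trans (s≤s (m≤n+m∸n p c)) (≤-reflexive (sym (+-suc c (p ∸ c))))

f-step-∈ : ∀ T p → suc p ∈ T → f T (suc p) ≤ f T p
f-step-∈ T p 1+p∈T = begin
  suc p ∸ countLe T (suc p)     ≡⟨ cong (suc p ∸_) (countLe-suc T p) ⟩
  suc p ∸ (c + mult (suc p) T)  ≤⟨ ∸-monoʳ-≤ (suc p) 1+c≤c+mult ⟩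
  suc p ∸ suc c                 ∎
  where
  open ≤-Reasoning
  c : ℕ
  c = countLe T p
  1+c≤c+mult : suc c ≤ c + mult (suc p) T
  1+c≤c+mult = ≤-trans (≤-reflexive (+-comm 1 c)) (+-monoʳ-≤ c (mult-∈ 1+p∈T))

f-positive : ∀ T i → Linked _<_ T → All (0 <_) T → 1 ≤ i → ¬ i ∈ T → 1 ≤ f T i
f-positive T (suc q) l pos _ i∉T = subst (λ c → 1 ≤ suc q ∸ c) (sym countLe-eq)
  (m<n⇒0<n∸m (s≤s (countLe-bound T q l pos)))
  where
  countLe-eq : countLe T (suc q) ≡ countLe T q
  countLe-eq = trans (countLe-suc T q)
                 (trans (cong (countLe T q +_) (mult-∉ T i∉T)) (+-identityʳ _))

f-at-end : ∀ T n k → length T ≡ k → n ∸ k ≤ f T n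
f-at-end T n k refl = ∸-monoʳ-≤ n (length-filter (_≤? n) T)

-- Discrete intermediate value theorem: every value 1 ≤ v ≤ f_T(p) is taken by
-- f_T at some point q ≤ p outside T (the first point where f_T reaches v).
f-takes-values : ∀ T v p → 1 ≤ v → v ≤ f T p →
                 Σ ℕ λ q → (1 ≤ q × q ≤ p) × ¬ q ∈ T × f T q ≡ v
f-takes-values T v zero 1≤v v≤f0 =
  ⊥-elim (<⇒≱ 1≤v (subst (v ≤_) (0∸n≡0 (countLe T 0)) v≤f0))
f-takes-values T v (suc r) 1≤v v≤f[1+r] with v ≤? f T r
... | yes v≤fr =
  let (q , (1≤q , q≤r) , q∉T , fq≡v) = f-takes-values T v r 1≤v v≤fr
  in q , (1≤q , m≤n⇒m≤1+n q≤r) , q∉T , fq≡v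
... | no v≰fr = suc r , (s≤s z≤n , ≤-refl) , 1+r∉T , f[1+r]≡v
  where
  fr<v : f T r < v
  fr<v = ≰⇒> v≰fr
  f[1+r]≡v : f T (suc r) ≡ v
  f[1+r]≡v = ≤-antisym (≤-trans (f-step T r) fr<v) v≤f[1+r]
  1+r∉T : ¬ suc r ∈ T
  1+r∉T 1+r∈T = <⇒≱ fr<v (≤-trans v≤f[1+r] (f-step-∈ T r 1+r∈T))

parts≥ : ℕ → List ℕ → ℕ
parts≥ i λ′ = length (filter (i ≤?_) λ′)

parts≥-shift1 : ∀ i λ′ → parts≥ (suc i) (shift1 λ′) ≡ parts≥ (suc (suc i)) λ′
parts≥-shift1 i [] = refl
parts≥-shift1 i (zero ∷ λ′) = parts≥-shift1 i λ′
parts≥-shift1 i (suc x ∷ λ′) with suc i ≤? x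
... | yes i<x
  rewrite filter-accept (suc i ≤?_) {x} {shift1 λ′} i<x
        | filter-accept (suc (suc i) ≤?_) {suc x} {λ′} (s≤s i<x)
  = cong suc (parts≥-shift1 i λ′)
... | no i≮x
  rewrite filter-reject (suc i ≤?_) {x} {shift1 λ′} i≮x
        | filter-reject (suc (suc i) ≤?_) {suc x} {λ′} (i≮x ∘ ≤-pred)
  = parts≥-shift1 i λ′

maxPart-shift1 : ∀ λ′ → maxPart (shift1 λ′) ≡ maxPart λ′ ∸ 1
maxPart-shift1 [] = refl
maxPart-shift1 (x ∷ λ′) =
  trans (cong ((x ∸ 1) ⊔_) (maxPart-shift1 λ′)) (sym (∸-distribʳ-⊔ 1 x (maxPart λ′)))

-- For λ with positive parts, λ^∨ = (ℓ(λ), λ[1]^∨): the first column of the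
-- Young diagram has length ℓ(λ), and removing it leaves the diagram of λ[1].
dual-cons : ∀ x λ′ → All (1 ≤_) (x ∷ λ′) →
            dual (x ∷ λ′) ≡ length (x ∷ λ′) ∷ dual (shift1 (x ∷ λ′))
dual-cons x λ′ pos@(1≤x ∷ _) = begin
  map g (upTo (maxPart P))           ≡⟨ cong (map g ∘ upTo) maxPart≡1+M′ ⟩
  g 0 ∷ map g (applyUpTo suc M′)     ≡⟨ cong₂ _∷_ first-column other-columns ⟩
  length P ∷ dual (shift1 P)         ∎
  where
  open ≡-Reasoning
  P : List ℕ
  P = x ∷ λ′
  M′ : ℕ
  M′ = maxPart (shift1 P)
  g : ℕ → ℕ
  g i = parts≥ (suc i) P
  maxPart≡1+M′ : maxPart P ≡ suc M′
  maxPart≡1+M′ = trans (+-∸-assoc 1 {maxPart P} {1} (≤-trans 1≤x (m≤m⊔n x (maxPart λ′))))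
                       (cong suc (sym (maxPart-shift1 P)))
  first-column : g 0 ≡ length P
  first-column = cong length (filter-all (1 ≤?_) pos)
  other-columns : map g (applyUpTo suc M′) ≡ dual (shift1 P)
  other-columns = begin
    map g (applyUpTo suc M′)    ≡⟨ map-applyUpTo suc g M′ ⟩
    applyUpTo (g ∘ suc) M′      ≡⟨ sym (map-applyUpTo (λ i → i) (g ∘ suc) M′) ⟩
    map (g ∘ suc) (upTo M′)     ≡⟨ map-cong (λ i → sym (parts≥-shift1 i P)) (upTo M′) ⟩
    dual (shift1 P)             ∎

cuts-cons⁺ : ∀ k D {s} → s ∈ cuts D → k + s ∈ cuts (k ∷ D)
cuts-cons⁺ k (_ ∷ _) s∈ = there (∈-map⁺ (k +_) s∈)

cuts-cons⁻ : ∀ k D {s} → 1 ≤ s → k + s ∈ cuts (k ∷ D) → s ∈ cuts D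
cuts-cons⁻ k (_ ∷ _) {s} 1≤s (here k+s≡k) =
  ⊥-elim (<⇒≢ 1≤s (sym (+-cancelˡ-≡ k s 0 (trans k+s≡k (sym (+-identityʳ k))))))
cuts-cons⁻ k (y ∷ D) {s} _ (there k+s∈) with ∈-map⁻ (k +_) k+s∈
... | t , t∈ , k+s≡k+t = subst (_∈ cuts (y ∷ D)) (sym (+-cancelˡ-≡ k s t k+s≡k+t)) t∈

cut-shift⁺ : ∀ {λ′ k s} → All (1 ≤_) λ′ → length λ′ ≡ k →
             s ∈ cuts (dual (shift1 λ′)) → k + s ∈ cuts (dual λ′)
cut-shift⁺ {x ∷ λ′} pos refl s∈ rewrite dual-cons x λ′ pos = cuts-cons⁺ _ _ s∈

cut-shift⁻ : ∀ {λ′ k s} → All (1 ≤_) λ′ → length λ′ ≡ k → 1 ≤ s →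
             k + s ∈ cuts (dual λ′) → s ∈ cuts (dual (shift1 λ′))
cut-shift⁻ {x ∷ λ′} pos refl 1≤s k+s∈ rewrite dual-cons x λ′ pos = cuts-cons⁻ _ _ 1≤s k+s∈

translate : ℕ → Root → Root
translate k (i , j) = (k + i , k + j)

Δ-translate⁺ : ∀ {n k γ} → InΔ (n ∸ k) γ → InΔ n (translate k γ)
Δ-translate⁺ {n} {k} (m , 1≤m , 1+m≤n∸k , refl) =
  k + m , ≤-trans 1≤m (m≤n+m m k) , 1+k+m≤n , cong (k + m ,_) (+-suc k m)
  where
  k<n : k < n
  k<n = m∸n≢0⇒n<m (λ n∸k≡0 → <⇒≱ (s≤s z≤n) (subst (suc m ≤_) n∸k≡0 1+m≤n∸k))
  1+k+m≤n : suc (k + m) ≤ n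
  1+k+m≤n = subst₂ _≤_ (+-suc k m) (m+[n∸m]≡n (<⇒≤ k<n)) (+-monoʳ-≤ k 1+m≤n∸k)

Δ-translate⁻ : ∀ {n k i j} → 1 ≤ i → InΔ n (translate k (i , j)) → InΔ (n ∸ k) (i , j)
Δ-translate⁻ {n} {k} {i} {j} 1≤i (m , _ , 1+m≤n , e) =
  i , 1≤i , m+n≤o⇒m≤o∸n (suc i) 1+i+k≤n , cong (i ,_) j≡1+i
  where
  k+i≡m : k + i ≡ m
  k+i≡m = ,-injectiveˡ e
  j≡1+i : j ≡ suc i
  j≡1+i = +-cancelˡ-≡ k j (suc i)
            (trans (,-injectiveʳ e) (trans (cong suc (sym k+i≡m)) (sym (+-suc k i))))
  1+i+k≤n : suc i + k ≤ n
  1+i+k≤n = subst (λ x → suc x ≤ n) (trans (sym k+i≡m) (+-comm k i)) 1+m≤n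

CutRoot : List ℕ → Root → Set
CutRoot μ β = Σ ℕ λ s → s ∈ cuts μ × β ≡ α s

cutRoot-translate⁺ : ∀ {λ′ k γ} → All (1 ≤_) λ′ → length λ′ ≡ k →
                     CutRoot (dual (shift1 λ′)) γ → CutRoot (dual λ′) (translate k γ)
cutRoot-translate⁺ {k = k} pos len (s , s∈ , refl) =
  k + s , cut-shift⁺ pos len s∈ , cong (k + s ,_) (+-suc k s)

cutRoot-translate⁻ : ∀ {m λ′ k γ} → All (1 ≤_) λ′ → length λ′ ≡ k → InΔ m γ →
                     CutRoot (dual λ′) (translate k γ) → CutRoot (dual (shift1 λ′)) γ
cutRoot-translate⁻ {λ′ = λ′} pos len (i , 1≤i , _ , refl) (s , s∈ , e) =
  i , cut-shift⁻ pos len 1≤i (subst (_∈ cuts (dual λ′)) (sym (,-injectiveˡ e)) s∈) , refl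

𝕁-translate⁺ : ∀ {n k λ′ γ} → All (1 ≤_) λ′ → length λ′ ≡ k → InΔ (n ∸ k) γ →
               In𝕁 (n ∸ k) (shift1 λ′) γ → In𝕁 n λ′ (translate k γ)
𝕁-translate⁺ pos len γ∈Δ (_ , γ∉J) =
  Δ-translate⁺ γ∈Δ , λ (_ , noCut) → γ∉J (γ∈Δ , noCut ∘ cutRoot-translate⁺ pos len)

𝕁-translate⁻ : ∀ {n k λ′ γ} → All (1 ≤_) λ′ → length λ′ ≡ k → InΔ (n ∸ k) γ →
               In𝕁 n λ′ (translate k γ) → In𝕁 (n ∸ k) (shift1 λ′) γ
𝕁-translate⁻ pos len γ∈Δ (_ , γ∉J) =
  γ∈Δ , λ (_ , noCut) → γ∉J (Δ-translate⁺ γ∈Δ , noCut ∘ cutRoot-translate⁻ pos len γ∈Δ)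

w-off-T : ∀ k T {p} → ¬ p ∈ T → w k T p ≡ k + f T p
w-off-T k T {p} p∉T with p ∈? T
... | yes p∈T = ⊥-elim (p∉T p∈T)
... | no _ = refl

wRoot-on-ΦT : ∀ {n k T β} → InΦT n T β → wRoot k T β ≡ translate k (φ T β)
wRoot-on-ΦT {k = k} {T} (_ , i∉T , j∉T) = cong₂ _,_ (w-off-T k T i∉T) (w-off-T k T j∉T)

φ-onto-Δ : ∀ {n k T γ} → length T ≡ k → InΔ (n ∸ k) γ →
           Σ Root λ β → InΦT n T β × φ T β ≡ γ
φ-onto-Δ {n} {k} {T} lenT (m , 1≤m , 1+m≤n∸k , refl)
  with f-takes-values T m n 1≤m (≤-trans (n≤1+n m) 1+m≤fn)
     | f-takes-values T (suc m) n (s≤s z≤n) 1+m≤fn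
  where
  1+m≤fn : suc m ≤ f T n
  1+m≤fn = ≤-trans 1+m≤n∸k (f-at-end T n k lenT)
... | i , i∈[n] , i∉T , fi≡m | j , j∈[n] , j∉T , fj≡1+m =
  (i , j) , ((i∈[n] , j∈[n] , i≢j) , i∉T , j∉T) , cong₂ _,_ fi≡m fj≡1+m
  where
  i≢j : i ≢ j
  i≢j i≡j = <⇒≢ (n<1+n m) (trans (sym fi≡m) (trans (cong (f T) i≡j) fj≡1+m))

φ-simple : ∀ {n k T β} → Linked _<_ T → All (λ t → 1 ≤ t × t ≤ n) T →
           InΦT n T β → InΔ n (wRoot k T β) → InΔ (n ∸ k) (φ T β)
φ-simple {n} {T = T} {β = i , _} increasing bounds β∈ΦT@(((1≤i , _) , _) , i∉T , _) wβ∈Δ =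
  Δ-translate⁻ (f-positive T i increasing (All.map proj₁ bounds) 1≤i i∉T)
               (subst (InΔ n) (wRoot-on-ΦT β∈ΦT) wβ∈Δ)

module Correspondence {n k : ℕ} {λ′ T : List ℕ}
  (pos : All (1 ≤_) λ′) (lenλ : length λ′ ≡ k)
  (increasing : Linked _<_ T) (bounds : All (λ t → 1 ≤ t × t ≤ n) T) (lenT : length T ≡ k)
  where

  lift : ∀ {γ} → InΔ (n ∸ k) γ →
         Σ Root λ β → InΦT n T β × φ T β ≡ γ × wRoot k T β ≡ translate k γ
  lift γ∈Δ with φ-onto-Δ lenT γ∈Δ
  ... | β , β∈ΦT , φβ≡γ = β , β∈ΦT , φβ≡γ , trans (wRoot-on-ΦT β∈ΦT) (cong (translate k) φβ≡γ)

  part1 : ∀ γ → In𝕁 (n ∸ k) (shift1 λ′) γ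
                ⇔ Σ Root (λ β → (InΦT n T β × In𝕁 n λ′ (wRoot k T β)) × φ T β ≡ γ)
  part1 γ = mk⇔ to from
    where
    to : In𝕁 (n ∸ k) (shift1 λ′) γ →
         Σ Root (λ β → (InΦT n T β × In𝕁 n λ′ (wRoot k T β)) × φ T β ≡ γ)
    to γ∈𝕁@(γ∈Δ , _) with lift γ∈Δ
    ... | β , β∈ΦT , φβ≡γ , wβ≡k+γ =
      β , (β∈ΦT , subst (In𝕁 n λ′) (sym wβ≡k+γ) (𝕁-translate⁺ pos lenλ γ∈Δ γ∈𝕁)) , φβ≡γ
    from : Σ Root (λ β → (InΦT n T β × In𝕁 n λ′ (wRoot k T β)) × φ T β ≡ γ) →
           In𝕁 (n ∸ k) (shift1 λ′) γ
    from (β , (β∈ΦT , wβ∈𝕁@(wβ∈Δ , _)) , refl) =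
      𝕁-translate⁻ pos lenλ (φ-simple increasing bounds β∈ΦT wβ∈Δ)
                   (subst (In𝕁 n λ′) (wRoot-on-ΦT β∈ΦT) wβ∈𝕁)

  part2 : ∀ γ → (InΔ (n ∸ k) γ × ¬ In𝕁 (n ∸ k) (shift1 λ′) γ)
                ⇔ Σ Root (λ β → (InΦT n T β × (InΔ n (wRoot k T β) × ¬ In𝕁 n λ′ (wRoot k T β))) × φ T β ≡ γ)
  part2 γ = mk⇔ to from
    where
    to : InΔ (n ∸ k) γ × ¬ In𝕁 (n ∸ k) (shift1 λ′) γ →
         Σ Root (λ β → (InΦT n T β × (InΔ n (wRoot k T β) × ¬ In𝕁 n λ′ (wRoot k T β))) × φ T β ≡ γ)
    to (γ∈Δ , γ∉𝕁) with lift γ∈Δ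
    ... | β , β∈ΦT , φβ≡γ , wβ≡k+γ =
      β , (β∈ΦT , subst (InΔ n) (sym wβ≡k+γ) (Δ-translate⁺ γ∈Δ) ,
           γ∉𝕁 ∘ 𝕁-translate⁻ pos lenλ γ∈Δ ∘ subst (In𝕁 n λ′) wβ≡k+γ) , φβ≡γ
    from : Σ Root (λ β → (InΦT n T β × (InΔ n (wRoot k T β) × ¬ In𝕁 n λ′ (wRoot k T β))) × φ T β ≡ γ) →
           InΔ (n ∸ k) γ × ¬ In𝕁 (n ∸ k) (shift1 λ′) γ
    from (β , (β∈ΦT , wβ∈Δ , wβ∉𝕁) , refl) =
      φβ∈Δ , wβ∉𝕁 ∘ subst (In𝕁 n λ′) (sym (wRoot-on-ΦT β∈ΦT)) ∘ 𝕁-translate⁺ pos lenλ φβ∈Δ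
      where
      φβ∈Δ : InΔ (n ∸ k) (φ T β)
      φβ∈Δ = φ-simple increasing bounds β∈ΦT wβ∈Δ

lemma5p23 : (n k : ℕ) (h : ℕ → ℕ) (λ′ T : List ℕ) →
    IsHessenberg n h → IsPartition n k λ′ → IsSK n h k T →
    (∀ γ → In𝕁 (n ∸ k) (shift1 λ′) γ
             ⇔ Σ Root (λ β → (InΦT n T β × In𝕁 n λ′ (wRoot k T β)) × φ T β ≡ γ))
    ×
    (∀ γ → (InΔ (n ∸ k) γ × ¬ In𝕁 (n ∸ k) (shift1 λ′) γ)
             ⇔ Σ Root (λ β → (InΦT n T β × (InΔ n (wRoot k T β) × ¬ In𝕁 n λ′ (wRoot k T β))) × φ T β ≡ γ))
lemma5p23 n k _ λ′ T _ (pos , _ , _ , lenλ) (increasing , bounds , lenT , _) = part1 , part2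
  where open Correspondence pos lenλ increasing bounds lenT
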